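{- Let $f$ be a real-valued arithmetic function, $n\in\mathbb{N}$, $c>0$ a real number, and $J>k\ge0$ integers. Suppose that (a) $|\triangle^k f(n+j)|\le c$ for $j=0,1,\ldots,J-1-k$; and (b) $f(n+j)\in[0,c]$ for $j=0,1,\ldots,k-1$. Then \[|f(n+j)|\le(k+1)j^kc\qquad\text{for } j=k,k+1,\ldots,J-1.\]
   Context: $\mathbb{N}=\{0,1,2,\ldots\}$; $(\triangle f)(n)=f(n+1)-f(n)$ and $\triangle^k$ is its $k$-fold iterate ($\triangle^0$ the identity). -}

module Defs where

open import Level using (_⊔_)
open import Data.Nat using (ℕ; zero; suc)
open import Data.Product using (_×_; ∃)
open import Relation.Nullary using (¬_)
open import Relation.Binary.Structures using (IsTotalOrder)
open import Algebra.Bundles using (CommutativeRing)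

-- An ordered field (the real numbers are one).
record OrderedField (a ℓ₁ ℓ₂ : Level.Level) : Set (Level.suc (a ⊔ ℓ₁ ⊔ ℓ₂)) where
  field
    commutativeRing : CommutativeRing a ℓ₁
  open CommutativeRing commutativeRing public
  infix 4 _≤_
  field
    _≤_          : Carrier → Carrier → Set ℓ₂
    isTotalOrder : IsTotalOrder _≈_ _≤_
    +-monoˡ-≤    : ∀ {x y} z → x ≤ y → x + z ≤ y + z
    *-nonneg     : ∀ {x y} → 0# ≤ x → 0# ≤ y → 0# ≤ x * y
    nontrivial   : ¬ (1# ≈ 0#)
    inverse      : ∀ x → ¬ (x ≈ 0#) → ∃ λ y → x * y ≈ 1#

  infix 4 _<_
  _<_ : Carrier → Carrier → Set (ℓ₁ ⊔ ℓ₂)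
  x < y = (x ≤ y) × ¬ (x ≈ y)

  ∣_∣≤_ : Carrier → Carrier → Set ℓ₂
  ∣ x ∣≤ b = (- b ≤ x) × (x ≤ b)

  ι : ℕ → Carrier
  ι zero    = 0#
  ι (suc n) = 1# + ι n

  △ : (ℕ → Carrier) → (ℕ → Carrier)
  △ f m = f (suc m) - f m

  △^ : ℕ → (ℕ → Carrier) → (ℕ → Carrier)
  △^ zero    f = f
  △^ (suc k) f = △^ k (△ f)

{-# OPTIONS --safe #-}
-- Strengthen the claim by letting the first k values of f be bounded by d·c
-- instead of c: then |f j| ≤ j^k (1 + k d) c for k ≤ j < J, by induction on k.
-- For k + 1, the difference △f satisfies the hypotheses for k with d doubled,
-- and f j is recovered from f (k + 1) by summing △f, the bounds being kept in
-- check by a^(k+1) + (k+1) a^k ≤ (a+1)^(k+1).  Every bound is a natural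
-- multiple of c, so all the estimates reduce to inequalities in ℕ.
module Submission where

open import Defs
open import Data.Nat using (ℕ; zero; suc)
import Data.Nat as N
open import Data.Product using (_×_; _,_)
open import Data.Sum using (inj₁; inj₂)
open import Relation.Binary.Structures using (IsTotalOrder)

module EnvelopeArithmetic where

  open import Data.Nat
  open import Data.Nat.Properties
  open import Data.Nat.Tactic.RingSolver using (solve-∀)
  open import Relation.Binary.PropositionalEquality
  open ≤-Reasoning

  binomial-lower-bound : ∀ a k → a ^ suc k + suc k * a ^ k ≤ suc a ^ suc k
  binomial-lower-bound a zero    = ≤-reflexive (+-comm (a * 1) 1)
  binomial-lower-bound a (suc k) = begin
    a ^ suc (suc k) + suc (suc k) * a ^ suc k                  ≤⟨ m≤m+n _ (suc k * a ^ k) ⟩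
    a ^ suc (suc k) + suc (suc k) * a ^ suc k + suc k * a ^ k  ≡⟨ expand a k (a ^ k) ⟩
    suc a * (a ^ suc k + suc k * a ^ k)                        ≤⟨ *-monoʳ-≤ (suc a) (binomial-lower-bound a k) ⟩
    suc a ^ suc (suc k)                                        ∎
    where
    expand : ∀ a k y → a * (a * y) + (2 + k) * (a * y) + suc k * y ≡ suc a * (a * y + suc k * y)
    expand = solve-∀

  n^n>0 : ∀ n → n ^ n > 0
  n^n>0 zero    = ≤-refl
  n^n>0 (suc n) = m^n>0 (suc n) (suc n)

  envelope : ℕ → ℕ → ℕ → ℕ
  envelope k d j = j ^ k * (1 + k * d)

  envelope-weights : ∀ k d → d + (1 + k * (d + d)) ≤ suc k * (1 + suc k * d)
  envelope-weights k d = ≤-trans (m≤m+n _ (k + k * k * d)) (≤-reflexive (expand k d))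
    where
    expand : ∀ k d → d + (1 + k * (d + d)) + (k + k * k * d) ≡ suc k * (1 + suc k * d)
    expand = solve-∀

  envelope-step : ∀ k d i → envelope (suc k) d i + envelope k (d + d) i ≤ envelope (suc k) d (suc i)
  envelope-step k d i = begin
    i ^ suc k * x + i ^ k * y          ≤⟨ +-monoʳ-≤ (i ^ suc k * x) (*-monoʳ-≤ (i ^ k) y≤[1+k]x) ⟩
    i ^ suc k * x + i ^ k * (suc k * x) ≡⟨ regroup (i ^ suc k) (i ^ k) (suc k) x ⟩
    (i ^ suc k + suc k * i ^ k) * x     ≤⟨ *-monoˡ-≤ x (binomial-lower-bound i k) ⟩
    suc i ^ suc k * x                   ∎
    where
    x = 1 + suc k * d
    y = 1 + k * (d + d)
    y≤[1+k]x : y ≤ suc k * x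
    y≤[1+k]x = ≤-trans (m≤n+m y d) (envelope-weights k d)
    regroup : ∀ a b s x → a * x + b * (s * x) ≡ (a + s * b) * x
    regroup = solve-∀

  envelope-start : ∀ k d → d + envelope k (d + d) k ≤ envelope (suc k) d (suc k)
  envelope-start k d = begin
    d + k ^ k * y             ≤⟨ +-monoˡ-≤ (k ^ k * y) (m≤n*m d (k ^ k) {{>-nonZero (n^n>0 k)}}) ⟩
    k ^ k * d + k ^ k * y     ≡⟨ *-distribˡ-+ (k ^ k) d y ⟨
    k ^ k * (d + y)           ≤⟨ *-monoʳ-≤ (k ^ k) (envelope-weights k d) ⟩
    k ^ k * (suc k * x)       ≡⟨ *-assoc (k ^ k) (suc k) x ⟨
    k ^ k * suc k * x         ≤⟨ *-monoˡ-≤ x (*-monoˡ-≤ (suc k) (^-monoˡ-≤ k (n≤1+n k))) ⟩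
    suc k ^ k * suc k * x     ≡⟨ cong (_* x) (*-comm (suc k ^ k) (suc k)) ⟩
    suc k ^ suc k * x         ∎
    where
    x = 1 + suc k * d
    y = 1 + k * (d + d)

  envelope-one : ∀ k j → envelope k 1 j ≡ suc k * j ^ k
  envelope-one k j = trans (cong (λ m → j ^ k * suc m) (*-identityʳ k)) (*-comm (j ^ k) (suc k))

module OrderedFieldProperties {a ℓ₁ ℓ₂} (F : OrderedField a ℓ₁ ℓ₂) where

  open OrderedField F
  open IsTotalOrder isTotalOrder public
    using (total; ≤-respˡ-≈; ≤-respʳ-≈)
    renaming (reflexive to ≤-reflexive; trans to ≤-trans)
  open import Algebra.Properties.Ring ring
    using (-0#≈0#; -‿involutive; -‿+-comm; -1*x≈-x)
  import Data.Nat.Properties as ℕ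
  import Relation.Binary.PropositionalEquality as ≡

  +-monoʳ-≤ : ∀ {x y} z → x ≤ y → z + x ≤ z + y
  +-monoʳ-≤ {x} {y} z x≤y = ≤-respˡ-≈ (+-comm x z) (≤-respʳ-≈ (+-comm y z) (+-monoˡ-≤ z x≤y))

  +-mono-≤ : ∀ {x y u v} → x ≤ y → u ≤ v → x + u ≤ y + v
  +-mono-≤ {y = y} {u} x≤y u≤v = ≤-trans (+-monoˡ-≤ u x≤y) (+-monoʳ-≤ y u≤v)

  x≤x+y : ∀ {x y} → 0# ≤ y → x ≤ x + y
  x≤x+y {x} 0≤y = ≤-respˡ-≈ (+-identityʳ x) (+-monoʳ-≤ x 0≤y)

  -‿antimono-≤ : ∀ {x y} → x ≤ y → - y ≤ - x
  -‿antimono-≤ {x} {y} x≤y = ≤-respˡ-≈ (cancel x (- y)) (≤-respʳ-≈ y-cancels (+-monoˡ-≤ (- x + - y) x≤y))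
    where
    cancel : ∀ u v → u + (- u + v) ≈ v
    cancel u v = trans (sym (+-assoc u (- u) v)) (trans (+-cong (-‿inverseʳ u) refl) (+-identityˡ v))
    y-cancels : y + (- x + - y) ≈ - x
    y-cancels = trans (+-cong refl (+-comm (- x) (- y))) (cancel y (- x))

  0≤1 : 0# ≤ 1#
  0≤1 with total 0# 1#
  ... | inj₁ 0≤1 = 0≤1
  ... | inj₂ 1≤0 = ≤-respʳ-≈ [-1][-1]≈1 (*-nonneg 0≤-1 0≤-1)
    where
    0≤-1 : 0# ≤ - 1#
    0≤-1 = ≤-respˡ-≈ -0#≈0# (-‿antimono-≤ 1≤0)
    [-1][-1]≈1 : - 1# * - 1# ≈ 1#
    [-1][-1]≈1 = trans (-1*x≈-x (- 1#)) (-‿involutive 1#)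

  *-monoˡ-≤-nonNeg : ∀ {x y z} → 0# ≤ z → x ≤ y → x * z ≤ y * z
  *-monoˡ-≤-nonNeg {x} {y} {z} 0≤z x≤y = ≤-respʳ-≈ split (x≤x+y (*-nonneg 0≤y-x 0≤z))
    where
    0≤y-x : 0# ≤ y - x
    0≤y-x = ≤-respˡ-≈ (-‿inverseʳ x) (+-monoˡ-≤ (- x) x≤y)
    split : x * z + (y - x) * z ≈ y * z
    split = trans (sym (distribʳ z x (y - x)))
                  (*-cong (trans (+-comm x (y - x)) (trans (+-assoc y (- x) x)
                          (trans (+-cong refl (-‿inverseˡ x)) (+-identityʳ y)))) refl)

  ι-nonneg : ∀ n → 0# ≤ ι n
  ι-nonneg zero    = ≤-reflexive refl
  ι-nonneg (suc n) = ≤-respˡ-≈ (+-identityˡ 0#) (+-mono-≤ 0≤1 (ι-nonneg n))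

  ι-+ : ∀ m n → ι (m N.+ n) ≈ ι m + ι n
  ι-+ zero    n = sym (+-identityˡ (ι n))
  ι-+ (suc m) n = trans (+-cong refl (ι-+ m n)) (sym (+-assoc 1# (ι m) (ι n)))

  ι-mono-≤ : ∀ {m n} → m N.≤ n → ι m ≤ ι n
  ι-mono-≤ {m} {n} m≤n = ≤-respʳ-≈ ι[m+[n∸m]]≈ι[n] (x≤x+y (ι-nonneg (n N.∸ m)))
    where
    ι[m+[n∸m]]≈ι[n] : ι m + ι (n N.∸ m) ≈ ι n
    ι[m+[n∸m]]≈ι[n] = trans (sym (ι-+ m (n N.∸ m))) (reflexive (≡.cong ι (ℕ.m+[n∸m]≡n m≤n)))

  ∣∣≤-+ : ∀ {x y p q} → ∣ x ∣≤ p → ∣ y ∣≤ q → ∣ x + y ∣≤ (p + q)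
  ∣∣≤-+ {p = p} {q} (-p≤x , x≤p) (-q≤y , y≤q) =
    ≤-respˡ-≈ (-‿+-comm p q) (+-mono-≤ -p≤x -q≤y) , +-mono-≤ x≤p y≤q

  0≤x≤p⇒∣x∣≤p : ∀ {x p} → 0# ≤ x → x ≤ p → ∣ x ∣≤ p
  0≤x≤p⇒∣x∣≤p 0≤x x≤p = ≤-trans (≤-respʳ-≈ -0#≈0# (-‿antimono-≤ (≤-trans 0≤x x≤p))) 0≤x , x≤p

  ∣∣≤-neg : ∀ {x p} → ∣ x ∣≤ p → ∣ - x ∣≤ p
  ∣∣≤-neg {p = p} (-p≤x , x≤p) = -‿antimono-≤ x≤p , ≤-respʳ-≈ (-‿involutive p) (-‿antimono-≤ -p≤x)

  ∣∣≤-weaken : ∀ {x p q} → p ≤ q → ∣ x ∣≤ p → ∣ x ∣≤ q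
  ∣∣≤-weaken p≤q (-p≤x , x≤p) = ≤-trans (-‿antimono-≤ p≤q) -p≤x , ≤-trans x≤p p≤q

  ∣∣≤-resp-≈ : ∀ {x y p} → x ≈ y → ∣ x ∣≤ p → ∣ y ∣≤ p
  ∣∣≤-resp-≈ x≈y (-p≤x , x≤p) = ≤-respʳ-≈ x≈y -p≤x , ≤-respˡ-≈ x≈y x≤p

module FiniteDifferences {a ℓ₁ ℓ₂} (F : OrderedField a ℓ₁ ℓ₂) where

  open OrderedField F
  open import Data.Nat.Properties using (+-suc)
  open import Relation.Binary.PropositionalEquality as ≡ using (_≡_)

  △-shift : ∀ f n m → △ (λ i → f (n N.+ i)) m ≡ △ f (n N.+ m)
  △-shift f n m = ≡.cong (λ i → f i - f (n N.+ m)) (+-suc n m)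

  △^-cong : ∀ k {f g} → (∀ m → f m ≡ g m) → ∀ m → △^ k f m ≡ △^ k g m
  △^-cong zero    f≗g = f≗g
  △^-cong (suc k) f≗g = △^-cong k (λ m → ≡.cong₂ _-_ (f≗g (suc m)) (f≗g m))

  △^-shift : ∀ k f n m → △^ k (λ i → f (n N.+ i)) m ≡ △^ k f (n N.+ m)
  △^-shift zero    f n m = ≡.refl
  △^-shift (suc k) f n m = ≡.trans (△^-cong k (△-shift f n) m) (△^-shift k (△ f) n m)

module MultiplesOf {a ℓ₁ ℓ₂} (F : OrderedField a ℓ₁ ℓ₂)
                   (c : OrderedField.Carrier F) (0≤c : OrderedField._≤_ F (OrderedField.0# F) c) where

  open OrderedField F
  open OrderedFieldProperties F
  open EnvelopeArithmetic
  open import Data.Nat using (_≤′_; ≤′-refl; ≤′-step; s≤s)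
  import Data.Nat.Properties as ℕ
  import Relation.Binary.PropositionalEquality as ≡

  infix 4 _≲_
  _≲_ : Carrier → ℕ → Set ℓ₂
  x ≲ p = ∣ x ∣≤ (ι p * c)

  ≲-weaken : ∀ {x p q} → p N.≤ q → x ≲ p → x ≲ q
  ≲-weaken p≤q = ∣∣≤-weaken (*-monoˡ-≤-nonNeg 0≤c (ι-mono-≤ p≤q))

  ≲-+ : ∀ {x y} p q → x ≲ p → y ≲ q → x + y ≲ p N.+ q
  ≲-+ p q x≲p y≲q = ∣∣≤-weaken (≤-reflexive ι-distrib) (∣∣≤-+ x≲p y≲q)
    where
    ι-distrib : ι p * c + ι q * c ≈ ι (p N.+ q) * c
    ι-distrib = trans (sym (distribʳ c (ι p) (ι q))) (*-cong (sym (ι-+ p q)) refl)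

  ≲-step : ∀ f i p q → f i ≲ p → △ f i ≲ q → f (suc i) ≲ p N.+ q
  ≲-step f i p q fi≲p △fi≲q = ∣∣≤-resp-≈ telescope (≲-+ p q fi≲p △fi≲q)
    where
    telescope : f i + △ f i ≈ f (suc i)
    telescope = trans (+-comm (f i) (△ f i))
                (trans (+-assoc (f (suc i)) (- f i) (f i))
                (trans (+-cong refl (-‿inverseˡ (f i))) (+-identityʳ (f (suc i)))))

  ≲-accumulate : ∀ f (B b : ℕ → ℕ) {s t} →
                 (∀ i → B i N.+ b i N.≤ B (suc i)) →
                 (∀ i → s N.≤ i → i N.< t → △ f i ≲ b i) →
                 f s ≲ B s →
                 ∀ j → s N.≤ j → j N.≤ t → f j ≲ B j
  ≲-accumulate f B b {s} {t} growth △f≲b fs≲Bs j s≤j = go (ℕ.≤⇒≤′ s≤j)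
    where
    go : ∀ {j} → s ≤′ j → j N.≤ t → f j ≲ B j
    go ≤′-refl            _   = fs≲Bs
    go (≤′-step {j} s≤′j) j<t =
      ≲-weaken (growth j) (≲-step f j (B j) (b j) (go s≤′j (ℕ.<⇒≤ j<t)) (△f≲b j (ℕ.≤′⇒≤ s≤′j) j<t))

  ≲-envelope : ∀ k f d J →
               (∀ m → m N.+ k N.< J → △^ k f m ≲ 1) →
               (∀ j → j N.< k → f j ≲ d) →
               ∀ j → k N.≤ j → j N.< J → f j ≲ envelope k d j
  ≲-envelope zero    f d J       △^kf≲1 _ j _ j<J =
    △^kf≲1 j (≡.subst (N._< J) (≡.sym (ℕ.+-identityʳ j)) j<J)
  ≲-envelope (suc k) f d zero    _      _ j _ ()
  ≲-envelope (suc k) f d (suc J) △^kf≲1 f≲d j k<j j<1+J =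
    ≲-accumulate f (envelope (suc k) d) (envelope k (d N.+ d)) (envelope-step k d)
                 (λ i k<i → △f≲ i (ℕ.<⇒≤ k<i)) f[1+k]≲ j k<j (ℕ.≤-pred j<1+J)
    where
    △f-hyp : ∀ m → m N.+ k N.< J → △^ k (△ f) m ≲ 1
    △f-hyp m m+k<J = △^kf≲1 m (≡.subst (N._< suc J) (≡.sym (ℕ.+-suc m k)) (s≤s m+k<J))
    △f-start : ∀ i → i N.< k → △ f i ≲ d N.+ d
    △f-start i i<k = ≲-+ d d (f≲d (suc i) (s≤s i<k)) (∣∣≤-neg (f≲d i (ℕ.m<n⇒m<1+n i<k)))
    △f≲ : ∀ i → k N.≤ i → i N.< J → △ f i ≲ envelope k (d N.+ d) i
    △f≲ = ≲-envelope k (△ f) (d N.+ d) J △f-hyp △f-start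
    k<J : k N.< J
    k<J = ℕ.≤-trans k<j (ℕ.≤-pred j<1+J)
    f[1+k]≲ : f (suc k) ≲ envelope (suc k) d (suc k)
    f[1+k]≲ = ≲-weaken (envelope-start k d)
                (≲-step f k d (envelope k (d N.+ d) k) (f≲d k ℕ.≤-refl) (△f≲ k ℕ.≤-refl k<J))

propositionA5 : ∀ {a ℓ₁ ℓ₂} (F : OrderedField a ℓ₁ ℓ₂) →
    let open OrderedField F in
    (f : ℕ → Carrier) (n : ℕ) (c : Carrier) → 0# < c →
    (J k : ℕ) → k N.< J →
    (∀ j → j N.+ k N.< J → ∣ △^ k f (n N.+ j) ∣≤ c) →
    (∀ j → j N.< k → (0# ≤ f (n N.+ j)) × (f (n N.+ j) ≤ c)) →
    ∀ j → k N.≤ j → j N.< J → ∣ f (n N.+ j) ∣≤ (ι (N.suc k N.* j N.^ k) * c)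
propositionA5 F f n c (0≤c , _) J k _ △^kf≤c f∈[0,c] j k≤j j<J =
  subst (λ p → ∣ f (n N.+ j) ∣≤ (ι p * c)) (envelope-one k j)
        (≲-envelope k (λ i → f (n N.+ i)) 1 J △^k-shifted≲1 shifted≲1 j k≤j j<J)
  where
  open OrderedField F
  open OrderedFieldProperties F
  open FiniteDifferences F
  open MultiplesOf F c 0≤c
  open EnvelopeArithmetic using (envelope-one)
  open import Relation.Binary.PropositionalEquality using (subst) renaming (sym to ≡-sym)
  ι1*c≈c : ι 1 * c ≈ c
  ι1*c≈c = trans (*-cong (+-identityʳ 1#) refl) (*-identityˡ c)
  △^k-shifted≲1 : ∀ m → m N.+ k N.< J → △^ k (λ i → f (n N.+ i)) m ≲ 1
  △^k-shifted≲1 m m+k<J = subst (_≲ 1) (≡-sym (△^-shift k f n m))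
                                (∣∣≤-weaken (≤-reflexive (sym ι1*c≈c)) (△^kf≤c m m+k<J))
  shifted≲1 : ∀ i → i N.< k → f (n N.+ i) ≲ 1
  shifted≲1 i i<k with f∈[0,c] i i<k
  ... | 0≤f , f≤c = 0≤x≤p⇒∣x∣≤p 0≤f (≤-trans f≤c (≤-reflexive (sym ι1*c≈c)))
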